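{- Let $K$ be a field, $T\in K^{m\times n\times p}$ with slices $T_1,\ldots,T_p$ and $r=\mathrm{rank}(T)$. Let $T'\in K^{(m+n)\times(m+n)\times(p+1)}$ be the tensor whose first slice is $I_{m+n}$ and whose remaining $p$ slices are $A_i=\begin{pmatrix}0_{m\times m}&T_i\\0_{n\times m}&0_{n\times n}\end{pmatrix}$, $i=1,\ldots,p$. Then $T'$ has a decomposition $T'=\sum_{i=1}^{r+m+n}u'_i\otimes v'_i\otimes w'_i$ with $w'_{i1}=1$ for all $i$.
   Context: $u\otimes v\otimes w$ has entries $u_iv_jw_k$; slices $T_k=(T_{ijk})_{i,j}$; tensor rank is the least number of such terms summing to $T$. -}

module Defs where

open import Level using (Level; _⊔_; suc)
open import Algebra.Bundles using (CommutativeRing)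
open import Data.Nat using (ℕ; _≤_) renaming (suc to sucℕ; _+_ to _+ℕ_)
open import Data.Fin using (Fin; zero; suc; splitAt; _≟_)
open import Data.Sum using (inj₁; inj₂)
open import Data.Product using (Σ; ∃; _×_; _,_)
open import Relation.Nullary using (¬_; yes; no)
import Algebra.Definitions.RawMonoid as RM

record Field (c ℓ : Level) : Set (Level.suc (c ⊔ ℓ)) where
  field
    commutativeRing : CommutativeRing c ℓ
  open CommutativeRing commutativeRing public
  field
    0≉1     : ¬ (0# ≈ 1#)
    inverse : ∀ x → ¬ (x ≈ 0#) → Σ Carrier λ y → x * y ≈ 1#

module _ {c ℓ : Level} (K : Field c ℓ) where
  open Field K

  Σ[_] : ∀ {k} → (Fin k → Carrier) → Carrier
  Σ[ f ] = RM.sum +-rawMonoid f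

  Tensor : ℕ → ℕ → ℕ → Set c
  Tensor m n p = Fin m → Fin n → Fin p → Carrier

  IsDecomposition : ∀ {m n p k} → Tensor m n p →
    (Fin k → Fin m → Carrier) → (Fin k → Fin n → Carrier) →
    (Fin k → Fin p → Carrier) → Set ℓ
  IsDecomposition {k = k} T u v w =
    ∀ i j l → T i j l ≈ Σ[ (λ (s : Fin k) → u s i * v s j * w s l) ]

  HasDecomposition : ∀ {m n p} → Tensor m n p → ℕ → Set (c ⊔ ℓ)
  HasDecomposition {m} {n} {p} T k =
    Σ (Fin k → Fin m → Carrier) λ u →
    Σ (Fin k → Fin n → Carrier) λ v →
    Σ (Fin k → Fin p → Carrier) λ w → IsDecomposition T u v w

  IsRank : ∀ {m n p} → Tensor m n p → ℕ → Set (c ⊔ ℓ)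
  IsRank T r = HasDecomposition T r × (∀ k → HasDecomposition T k → r ≤ k)

  identity : ∀ {N} → Fin N → Fin N → Carrier
  identity a b with a ≟ b
  ... | yes _ = 1#
  ... | no  _ = 0#

  blockSlice : ∀ {m n p} → Tensor m n p → Fin p → Fin (m +ℕ n) → Fin (m +ℕ n) → Carrier
  blockSlice {m} T l a b with splitAt m a | splitAt m b
  ... | inj₁ i | inj₂ j = T i j l
  ... | inj₁ _ | inj₁ _ = 0#
  ... | inj₂ _ | _      = 0#

  extendedTensor : ∀ {m n p} → Tensor m n p → Tensor (m +ℕ n) (m +ℕ n) (sucℕ p)
  extendedTensor T a b zero    = identity a b
  extendedTensor T a b (suc l) = blockSlice T l a b

{-# OPTIONS --safe #-}

-- Pad the terms of any decomposition T = Σ a_s ⊗ b_s ⊗ c_s to ã_s = (a_s, 0) and b̃_s = (0, b_s) in K^{m+n}, and give them the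
-- weight vectors (1, c_s): these r terms produce the slices A_l, but also put
-- P = Σ ã_s b̃_sᵀ into the first slice. The m+n further terms e_x ⊗ (I − P)_x ⊗ e₀,
-- one for each row x, touch only the first slice and turn P into I.

module Submission where

open import Defs
open import Level using (Level)
open import Data.Nat as ℕ using (ℕ)
import Data.Nat.Properties as ℕ
open import Data.Fin using (Fin; zero; suc; splitAt; cast; punchIn; _≟_)
open import Data.Fin.Properties using (punchInᵢ≢i)
open import Data.Fin.Permutation using (cast-id)
open import Data.Product using (Σ; _×_; _,_)
open import Data.Sum using (inj₁; inj₂)
open import Data.Sum.Properties using ([,]-map)
open import Data.Vec.Functional using (Vector; _++_; _∷_; replicate; tail; removeAt)
import Data.Vec.Functional.Relation.Unary.All.Properties as All
open import Function using (_∘_)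
open import Relation.Binary.PropositionalEquality as ≡ using (_≡_; _≢_)
open import Relation.Nullary using (yes; no; contradiction)

module _ {c ℓ : Level} (K : Field c ℓ) where
  open Field K hiding (zero)
  open import Algebra.Properties.Semiring.Sum semiring
    using (sum; sum-cong-≋; sum-cong-≗; sum-replicate-zero; sum-remove; sum-permute)
  open import Algebra.Properties.Group +-group using (\\-leftDividesˡ)
  open import Relation.Binary.Reasoning.Setoid setoid

  private variable
    m n p k k′ : ℕ

  sum-++ : (xs : Vector Carrier m) (ys : Vector Carrier n) → sum (xs ++ ys) ≈ sum xs + sum ys
  sum-++ {ℕ.zero}  xs ys = sym (+-identityˡ _)
  sum-++ {ℕ.suc m} xs ys = begin
    sum (xs ++ ys)                      ≡⟨ ≡.cong (xs zero +_) (sum-cong-≗ ([,]-map ∘ splitAt m)) ⟩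
    xs zero + sum (tail xs ++ ys)       ≈⟨ +-congˡ (sum-++ (tail xs) ys) ⟩
    xs zero + (sum (tail xs) + sum ys)  ≈⟨ +-assoc _ _ _ ⟨
    sum xs + sum ys                     ∎

  sum-≈0 : {f : Vector Carrier k} → (∀ s → f s ≈ 0#) → sum f ≈ 0#
  sum-≈0 {k} f≈0 = trans (sum-cong-≋ f≈0) (sum-replicate-zero k)

  identity-diag : (i : Fin n) → identity K i i ≡ 1#
  identity-diag i with i ≟ i
  ... | yes _   = ≡.refl
  ... | no i≢i = contradiction ≡.refl i≢i

  identity-offdiag : {i j : Fin n} → i ≢ j → identity K i j ≡ 0#
  identity-offdiag {i = i} {j} i≢j with i ≟ j
  ... | yes i≡j = contradiction i≡j i≢j
  ... | no _    = ≡.refl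

  sum-identity-select : (f : Vector Carrier n) (i : Fin n) → sum (λ x → identity K x i * f x) ≈ f i
  sum-identity-select {ℕ.suc n} f i = begin
    sum t                     ≈⟨ sum-remove t ⟩
    t i + sum (removeAt t i)  ≈⟨ +-cong diagonal (sum-≈0 off-diagonal) ⟩
    f i + 0#                  ≈⟨ +-identityʳ _ ⟩
    f i                       ∎
    where
    t : Vector Carrier (ℕ.suc n)
    t x = identity K x i * f x
    diagonal : t i ≈ f i
    diagonal = trans (*-congʳ (reflexive (identity-diag i))) (*-identityˡ _)
    off-diagonal : ∀ j → t (punchIn i j) ≈ 0#
    off-diagonal j = trans (*-congʳ (reflexive (identity-offdiag (punchInᵢ≢i i j)))) (zeroˡ _)

  infix  4 _≃_
  infixl 6 _⊕_
  infixl 7 _⊗_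

  _≃_ : Tensor K m n p → Tensor K m n p → Set ℓ
  T ≃ T′ = ∀ i j l → T i j l ≈ T′ i j l

  _⊕_ : Tensor K m n p → Tensor K m n p → Tensor K m n p
  (T ⊕ T′) i j l = T i j l + T′ i j l

  _⊗_ : (Fin m → Fin n → Carrier) → Vector Carrier p → Tensor K m n p
  (M ⊗ z) i j l = M i j * z l

  consSlice : (Fin m → Fin n → Carrier) → Tensor K m n p → Tensor K m n (ℕ.suc p)
  consSlice M T i j zero    = M i j
  consSlice M T i j (suc l) = T i j l

  blockTensor : Tensor K m n p → Tensor K (m ℕ.+ n) (m ℕ.+ n) p
  blockTensor T x y l = blockSlice K T l x y

  IsDecomposition-resp : {T T′ : Tensor K m n p} {u : Vector (Vector Carrier m) k}
    {v : Vector (Vector Carrier n) k} {w : Vector (Vector Carrier p) k} →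
    T ≃ T′ → IsDecomposition K T u v w → IsDecomposition K T′ u v w
  IsDecomposition-resp T≃T′ T≈uvw i j l = trans (sym (T≃T′ i j l)) (T≈uvw i j l)

  IsDecomposition-cast : {T : Tensor K m n p} {u : Vector (Vector Carrier m) k}
    {v : Vector (Vector Carrier n) k} {w : Vector (Vector Carrier p) k} →
    (eq : k′ ≡ k) → IsDecomposition K T u v w →
    IsDecomposition K T (u ∘ cast eq) (v ∘ cast eq) (w ∘ cast eq)
  IsDecomposition-cast eq T≈uvw i j l = trans (T≈uvw i j l) (sum-permute _ (cast-id eq))

  IsDecomposition-++ : {T T′ : Tensor K m n p}
    {u : Vector (Vector Carrier m) k} {v : Vector (Vector Carrier n) k} {w : Vector (Vector Carrier p) k}
    {u′ : Vector (Vector Carrier m) k′} {v′ : Vector (Vector Carrier n) k′} {w′ : Vector (Vector Carrier p) k′} →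
    IsDecomposition K T u v w → IsDecomposition K T′ u′ v′ w′ →
    IsDecomposition K (T ⊕ T′) (u ++ u′) (v ++ v′) (w ++ w′)
  IsDecomposition-++ {k = k} {T = T} {T′} {u} {v} {w} {u′} {v′} {w′} T≈uvw T′≈uvw′ i j l = begin
    T i j l + T′ i j l  ≈⟨ +-cong (T≈uvw i j l) (T′≈uvw′ i j l) ⟩
    sum f + sum f′      ≈⟨ sum-++ f f′ ⟨
    sum (f ++ f′)       ≡⟨ sum-cong-≗ term-++ ⟨
    sum (λ s → (u ++ u′) s i * (v ++ v′) s j * (w ++ w′) s l) ∎
    where
    f  = λ s → u s i * v s j * w s l
    f′ = λ s → u′ s i * v′ s j * w′ s l
    term-++ : ∀ s → (u ++ u′) s i * (v ++ v′) s j * (w ++ w′) s l ≡ (f ++ f′) s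
    term-++ s with splitAt k s
    ... | inj₁ _ = ≡.refl
    ... | inj₂ _ = ≡.refl

  IsDecomposition-consSlice : {T : Tensor K m n p} {u : Vector (Vector Carrier m) k}
    {v : Vector (Vector Carrier n) k} {w : Vector (Vector Carrier p) k} →
    (z : Vector Carrier k) → IsDecomposition K T u v w →
    IsDecomposition K (consSlice (λ i j → sum (λ s → u s i * v s j * z s)) T) u v (λ s → z s ∷ w s)
  IsDecomposition-consSlice z T≈uvw i j zero    = refl
  IsDecomposition-consSlice z T≈uvw i j (suc l) = T≈uvw i j l

  IsDecomposition-⊗ : (M : Fin m → Fin n → Carrier) (z : Vector Carrier p) →
                      IsDecomposition K (M ⊗ z) (identity K) M (λ _ → z)
  IsDecomposition-⊗ {m = m} M z i j l = sym (begin
    sum (λ x → identity K x i * M x j * z l)    ≈⟨ sum-cong-≋ {m} (λ x → *-assoc _ _ _) ⟩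
    sum (λ x → identity K x i * (M x j * z l))  ≈⟨ sum-identity-select (λ x → M x j * z l) i ⟩
    M i j * z l                                 ∎)

  IsDecomposition-blockTensor : {T : Tensor K m n p} {u : Vector (Vector Carrier m) k}
    {v : Vector (Vector Carrier n) k} {w : Vector (Vector Carrier p) k} →
    IsDecomposition K T u v w →
    IsDecomposition K (blockTensor T) (λ s → u s ++ replicate n 0#) (λ s → replicate m 0# ++ v s) w
  IsDecomposition-blockTensor {m = m} {k = k} T≈uvw x y l with splitAt m x | splitAt m y
  ... | inj₁ i | inj₂ j = T≈uvw i j l
  ... | inj₁ _ | inj₁ _ = sym (sum-≈0 {k} λ _ → trans (*-congʳ (zeroʳ _)) (zeroˡ _))
  ... | inj₂ _ | _      = sym (sum-≈0 {k} λ _ → trans (*-congʳ (zeroˡ _)) (zeroˡ _))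

  module ExtendedDecomposition {T : Tensor K m n p} {a : Vector (Vector Carrier m) k}
    {b : Vector (Vector Carrier n) k} {c : Vector (Vector Carrier p) k}
    (T≈abc : IsDecomposition K T a b c) where

    ã : Vector (Vector Carrier (m ℕ.+ n)) k
    ã s = a s ++ replicate n 0#

    b̃ : Vector (Vector Carrier (m ℕ.+ n)) k
    b̃ s = replicate m 0# ++ b s

    P : Fin (m ℕ.+ n) → Fin (m ℕ.+ n) → Carrier
    P x y = sum (λ s → ã s x * b̃ s y * 1#)

    -- I − P, written so that P + Q ≈ I is the group law \\-leftDividesˡ.
    Q : Fin (m ℕ.+ n) → Fin (m ℕ.+ n) → Carrier
    Q x y = - P x y + identity K x y

    e₀ : Vector Carrier (ℕ.suc p)
    e₀ = 1# ∷ replicate p 0#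

    U : Vector (Vector Carrier (m ℕ.+ n)) (k ℕ.+ (m ℕ.+ n))
    U = ã ++ identity K

    V : Vector (Vector Carrier (m ℕ.+ n)) (k ℕ.+ (m ℕ.+ n))
    V = b̃ ++ Q

    W : Vector (Vector Carrier (ℕ.suc p)) (k ℕ.+ (m ℕ.+ n))
    W = (λ s → 1# ∷ c s) ++ λ _ → e₀

    P-decomposition : IsDecomposition K (consSlice P (blockTensor T)) ã b̃ (λ s → 1# ∷ c s)
    P-decomposition =
      IsDecomposition-consSlice {k = k} (λ _ → 1#) (IsDecomposition-blockTensor {k = k} T≈abc)

    Q-decomposition : IsDecomposition K (Q ⊗ e₀) (identity K) Q (λ _ → e₀)
    Q-decomposition = IsDecomposition-⊗ Q e₀

    extendedTensor-split : consSlice P (blockTensor T) ⊕ Q ⊗ e₀ ≃ extendedTensor K T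
    extendedTensor-split x y zero    = trans (+-congˡ (*-identityʳ _)) (\\-leftDividesˡ (P x y) _)
    extendedTensor-split x y (suc l) = trans (+-congˡ (zeroʳ _)) (+-identityʳ _)

    decomposition : IsDecomposition K (extendedTensor K T) U V W
    decomposition =
      IsDecomposition-resp {k = k ℕ.+ (m ℕ.+ n)} extendedTensor-split
        (IsDecomposition-++ {k = k} {k′ = m ℕ.+ n} P-decomposition Q-decomposition)

    W-first : ∀ s → W s zero ≈ 1#
    W-first = All.++⁺ (λ z → z zero ≈ 1#) {xs = λ s → 1# ∷ c s} (λ _ → refl) (λ _ → refl)

open import Data.Nat using (_+_)

lemma7p4 : ∀ {c ℓ : Level} (K : Field c ℓ) (m n p : ℕ) (T : Tensor K m n p) (r : ℕ) →
    IsRank K T r →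
    Σ (Fin (r + m + n) → Fin (m + n) → Field.Carrier K) λ u′ →
    Σ (Fin (r + m + n) → Fin (m + n) → Field.Carrier K) λ v′ →
    Σ (Fin (r + m + n) → Fin (Data.Nat.suc p) → Field.Carrier K) λ w′ →
      IsDecomposition K (extendedTensor K T) u′ v′ w′ ×
      (∀ s → Field._≈_ K (w′ s zero) (Field.1# K))
lemma7p4 K m n p T r ((a , b , c , T≈abc) , _) =
  U ∘ cast eq , V ∘ cast eq , W ∘ cast eq ,
  IsDecomposition-cast K eq decomposition , W-first ∘ cast eq
  where
  open ExtendedDecomposition K {a = a} {b} {c} T≈abc
  eq : r + m + n ≡ r + (m + n)
  eq = ℕ.+-assoc r m n
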